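{- For any two integers $k$ and $\ell$ with $2\leq k\leq \ell$, there exists a connected graph $G$ with $\gamma_{\rm MBT}(G)=k$ and $\gamma_{\rm MBT}'(G)=\ell$.
   Context: All graphs are finite and simple. A set $D\subseteq V(G)$ is a total dominating set if every vertex of $G$ has a neighbor in $D$. In the Maker-Breaker total domination (MBTD) game on $G$, two players, Dominator and Staller, alternately select previously unselected vertices of $G$; Dominator wins if his selected vertices contain a total dominating set of $G$, otherwise Staller wins. In the D-game Dominator moves first, in the S-game Staller moves first. $\gamma_{\rm MBT}(G)$ (resp. $\gamma_{\rm MBT}'(G)$) is the minimum number of moves Dominator needs to win the D-game (resp. S-game) under optimal play (Dominator trying to win as fast as possible, Staller trying to prevent or delay his win), and is $\infty$ if Dominator has no winning strategy. -}

module Defs where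

open import Data.Nat using (ℕ; zero; suc; _≤_) renaming (_⊔_ to _⊔ℕ_; _⊓_ to _⊓ℕ_)
open import Data.Bool using (Bool; true; false; if_then_else_)
open import Data.Fin using (Fin)
open import Data.List using (List; []; _∷_; map; foldr)
open import Data.Bool.ListAction using (any; all)
open import Data.Vec using (Vec; []; _∷_; allFin; toList)
open import Data.Product using (_×_; _,_)
open import Relation.Binary.PropositionalEquality using (_≡_)

record Graph : Set where
  field
    n      : ℕ
    adj    : Fin n → Fin n → Bool
    sym    : ∀ u v → adj u v ≡ adj v u
    irrefl : ∀ v → adj v v ≡ false

open Graph public

data Walk (G : Graph) : Fin (n G) → Fin (n G) → Set where
  here : ∀ {u} → Walk G u u
  step : ∀ {u w v} → adj G u w ≡ true → Walk G w v → Walk G u v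

Connected : Graph → Set
Connected G = ∀ u v → Walk G u v

isTotalDominating : (G : Graph) → List (Fin (n G)) → Bool
isTotalDominating G D = all (λ v → any (λ u → adj G v u) D) (toList (allFin (n G)))

data ℕ∞ : Set where
  fin : ℕ → ℕ∞
  ∞   : ℕ∞

min∞ : ℕ∞ → ℕ∞ → ℕ∞
min∞ (fin a) (fin b) = fin (a ⊓ℕ b)
min∞ (fin a) ∞ = fin a
min∞ ∞ y = y

max∞ : ℕ∞ → ℕ∞ → ℕ∞
max∞ (fin a) (fin b) = fin (a ⊔ℕ b)
max∞ (fin a) ∞ = ∞
max∞ ∞ y = ∞

suc∞ : ℕ∞ → ℕ∞
suc∞ (fin a) = fin (suc a)
suc∞ ∞ = ∞

picks : ∀ {A : Set} {k} → Vec A (suc k) → List (A × Vec A k)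
picks (x ∷ []) = (x , []) ∷ []
picks (x ∷ y ∷ ys) = (x , y ∷ ys) ∷ map (λ { (z , zs) → (z , x ∷ zs) }) (picks (y ∷ ys))

-- State: D = Dominator's vertices so far, F = the currently unselected
-- vertices (Staller's vertices are irrelevant to the outcome).
-- Value = number of Dominator moves (in the whole game) still needed
-- under optimal play; ∞ if Staller can prevent Dominator from winning.

mutual
  valD : (G : Graph) → (k : ℕ) → List (Fin (n G)) → Vec (Fin (n G)) k → ℕ∞
  valD G zero D F = if isTotalDominating G D then fin 0 else ∞
  valD G (suc k) D F =
    if isTotalDominating G D then fin 0
    else foldr min∞ ∞ (map (λ { (v , F') → suc∞ (valS G k (v ∷ D) F') }) (picks F))

  valS : (G : Graph) → (k : ℕ) → List (Fin (n G)) → Vec (Fin (n G)) k → ℕ∞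
  valS G zero D F = if isTotalDominating G D then fin 0 else ∞
  valS G (suc k) D F =
    if isTotalDominating G D then fin 0
    else foldr max∞ (fin 0) (map (λ { (v , F') → valD G k D F' }) (picks F))

γMBT : Graph → ℕ∞
γMBT G = valD G (n G) [] (allFin (n G))

γMBT' : Graph → ℕ∞
γMBT' G = valS G (n G) [] (allFin (n G))

-- Two standard tools bound the game values. Packing: if w₁, …, w_m have pairwise disjoint open
-- neighbourhoods then every total dominating set has at least m vertices, so Dominator needs at
-- least m moves. Pairing: if m disjoint pairs of free vertices are such that every vertex not yet
-- dominated is adjacent to both vertices of some pair, Dominator wins within m moves by answering
-- every Staller move inside a pair with its partner.
--
-- Write k = b + 2 and ℓ = k + a. The graph has a vertex c adjacent to z₀ and z₁, and ℓ - 1 gadgets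
-- g, each consisting of x_g and two vertices y_g⁰, y_g¹ adjacent to x_g, z₀ and z₁; the a + 1
-- "near" gadgets also have x_g adjacent to c. In the D-game Dominator opens with c, which dominates
-- z₀, z₁ and the near x_g; the pairs {z₀, z₁} and {y_g⁰, y_g¹} (g far) take care of the rest, so
-- γ = 1 + (b + 1) = k, while y_{g₀}⁰, x_{g₀} (g₀ near) and the b far x_g form a packing of size k.
-- In the S-game the pairs {z₀, z₁} and all {y_g⁰, y_g¹} give γ' ≤ ℓ; Staller opens with c, after
-- which y_{g₀}⁰ and the ℓ - 1 vertices x_g have disjoint neighbourhoods among the remaining vertices.

{-# OPTIONS --safe #-}
module Submission where

open import Defs hiding (sym)
open import Data.Bool using (Bool; true; false; not; if_then_else_; _∨_; T)
open import Data.Bool.Properties using (∨-comm; not-¬; T-≡)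
open import Data.Empty using (⊥-elim)
open import Data.Fin using (Fin; zero; suc; splitAt; join; punchIn; punchOut; _≟_)
open import Data.Fin.Properties
  using ( 1↔⊤; 2↔Bool; +↔⊎; *↔×; join-splitAt; splitAt-join; injective⇒≤
        ; punchIn-injective; punchInᵢ≢i; punchIn-punchOut; any?)
open import Data.List using (List; []; _∷_; _++_; map; foldr; length)
import Data.List as List
open import Data.List.Properties using (++-identityʳ)
open import Data.List.Membership.Propositional using (_∈_)
open import Data.List.Membership.Propositional.Properties using (∈-map⁺; ∈-map⁻)
open import Data.List.Relation.Binary.Permutation.Propositional using (↭-sym)
open import Data.List.Relation.Binary.Permutation.Propositional.Properties using (Any-resp-↭; shift)
open import Data.List.Relation.Unary.All using (All; []; _∷_)
import Data.List.Relation.Unary.All as All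
open import Data.List.Relation.Unary.All.Properties using (all⁺; all⁻)
open import Data.List.Relation.Unary.Any using (Any; here; there)
import Data.List.Relation.Unary.Any as Any
open import Data.List.Relation.Unary.Any.Properties using (any⁺; any⁻)
open import Data.Nat using (ℕ; zero; suc; _+_; _*_; _≤_; z≤n; s≤s)
open import Data.Nat.Properties
  using ( ≤-refl; ≤-trans; ≤-antisym; ≤-pred; m⊓n≤m; m⊓n≤n; ⊓-glb; m≤m⊔n; m≤n⊔m; ⊔-lub
        ; +-comm; m≤n⇒∃[o]m+o≡n)
open import Data.Product using (Σ; ∃; ∃₂; _×_; _,_; proj₁; proj₂; uncurry)
open import Data.Product.Function.NonDependent.Propositional using (_×-↔_)
open import Data.Sum using (_⊎_; inj₁; inj₂; [_,_]′)
open import Data.Sum.Function.Propositional using (_⊎-↔_)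
open import Data.Sum.Properties using (≡-dec)
open import Data.Unit using (⊤; tt)
open import Data.Vec using (Vec; []; _∷_; allFin; tabulate; toList)
open import Data.Vec.Membership.Propositional using () renaming (_∈_ to _∈V_)
open import Data.Vec.Membership.Propositional.Properties using (∈-allFin⁺; ∈-toList⁺; ∈-tabulate⁺)
import Data.Vec.Relation.Unary.Any as VAny
import Data.Vec.Relation.Unary.Any.Properties as VAny
open import Function using (_∘_; id; Equivalence; Injective)
open import Function.Bundles using (_↔_; Inverse)
open import Function.Construct.Composition using (_↔-∘_)
open import Relation.Binary.Definitions using (DecidableEquality)
open import Relation.Binary.PropositionalEquality
  using (_≡_; _≢_; refl; sym; trans; cong; cong₂; subst)
open import Relation.Nullary using (Dec; yes; no)
open import Relation.Nullary.Decidable using (⌊_⌋; toWitness; fromWitness; map′; _⊎-dec_)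

infix 4 _≤∞_

data _≤∞_ : ℕ∞ → ℕ∞ → Set where
  fin≤fin : ∀ {m n} → m ≤ n → fin m ≤∞ fin n
  _≤∞-∞   : ∀ x → x ≤∞ ∞

≤∞-refl : ∀ {x} → x ≤∞ x
≤∞-refl {fin m} = fin≤fin ≤-refl
≤∞-refl {∞}     = ∞ ≤∞-∞

≤∞-trans : ∀ {x y z} → x ≤∞ y → y ≤∞ z → x ≤∞ z
≤∞-trans (fin≤fin p) (fin≤fin q) = fin≤fin (≤-trans p q)
≤∞-trans _           (y ≤∞-∞)    = _ ≤∞-∞

≤∞-antisym : ∀ {x y} → x ≤∞ y → y ≤∞ x → x ≡ y
≤∞-antisym (fin≤fin p) (fin≤fin q) = cong fin (≤-antisym p q)
≤∞-antisym (∞ ≤∞-∞)    _           = refl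

0≤∞ : ∀ {x} → fin 0 ≤∞ x
0≤∞ {fin m} = fin≤fin z≤n
0≤∞ {∞}     = _ ≤∞-∞

suc∞-mono : ∀ {x y} → x ≤∞ y → suc∞ x ≤∞ suc∞ y
suc∞-mono (fin≤fin p) = fin≤fin (s≤s p)
suc∞-mono (x ≤∞-∞)    = _ ≤∞-∞

min∞-≤ˡ : ∀ x y → min∞ x y ≤∞ x
min∞-≤ˡ (fin m) (fin n) = fin≤fin (m⊓n≤m m n)
min∞-≤ˡ (fin m) ∞       = ≤∞-refl
min∞-≤ˡ ∞       y       = _ ≤∞-∞

min∞-≤ʳ : ∀ x y → min∞ x y ≤∞ y
min∞-≤ʳ (fin m) (fin n) = fin≤fin (m⊓n≤n m n)
min∞-≤ʳ (fin m) ∞       = _ ≤∞-∞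
min∞-≤ʳ ∞       y       = ≤∞-refl

min∞-glb : ∀ {z x y} → z ≤∞ x → z ≤∞ y → z ≤∞ min∞ x y
min∞-glb (fin≤fin p) (fin≤fin q) = fin≤fin (⊓-glb p q)
min∞-glb {x = fin _} p (_ ≤∞-∞) = p
min∞-glb {x = ∞}     _ q        = q

max∞-lub : ∀ {x y z} → x ≤∞ z → y ≤∞ z → max∞ x y ≤∞ z
max∞-lub (fin≤fin p) (fin≤fin q) = fin≤fin (⊔-lub p q)
max∞-lub (x ≤∞-∞)    _           = _ ≤∞-∞

max∞-≥ˡ : ∀ x y → x ≤∞ max∞ x y
max∞-≥ˡ (fin m) (fin n) = fin≤fin (m≤m⊔n m n)
max∞-≥ˡ (fin m) ∞       = _ ≤∞-∞
max∞-≥ˡ ∞       y       = _ ≤∞-∞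

max∞-≥ʳ : ∀ x y → y ≤∞ max∞ x y
max∞-≥ʳ (fin m) (fin n) = fin≤fin (m≤n⊔m m n)
max∞-≥ʳ (fin m) ∞       = _ ≤∞-∞
max∞-≥ʳ ∞       y       = _ ≤∞-∞

if-≤∞ : ∀ b {x y} → (b ≡ false → x ≤∞ y) → (if b then fin 0 else x) ≤∞ y
if-≤∞ true  _ = 0≤∞
if-≤∞ false p = p refl

if-true-≤∞ : ∀ {b x y} → b ≡ true → (if b then fin 0 else x) ≤∞ y
if-true-≤∞ refl = 0≤∞

≤∞-if : ∀ b {x y} → (b ≡ true → y ≤∞ fin 0) → (b ≡ false → y ≤∞ x) → y ≤∞ (if b then fin 0 else x)
≤∞-if true  p _ = p refl
≤∞-if false _ q = q refl

module _ {A : Set} {g : A → ℕ∞} where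

  foldr-min∞-≤ : ∀ {xs p} → p ∈ xs → foldr min∞ ∞ (map g xs) ≤∞ g p
  foldr-min∞-≤ (here refl) = min∞-≤ˡ _ _
  foldr-min∞-≤ (there p∈)  = ≤∞-trans (min∞-≤ʳ _ _) (foldr-min∞-≤ p∈)

  foldr-min∞-glb : ∀ {z} xs → (∀ {p} → p ∈ xs → z ≤∞ g p) → z ≤∞ foldr min∞ ∞ (map g xs)
  foldr-min∞-glb []       _     = _ ≤∞-∞
  foldr-min∞-glb (x ∷ xs) bound = min∞-glb (bound (here refl)) (foldr-min∞-glb xs (bound ∘ there))

  foldr-max∞-lub : ∀ {z} xs → (∀ {p} → p ∈ xs → g p ≤∞ z) → foldr max∞ (fin 0) (map g xs) ≤∞ z
  foldr-max∞-lub []       _     = 0≤∞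
  foldr-max∞-lub (x ∷ xs) bound = max∞-lub (bound (here refl)) (foldr-max∞-lub xs (bound ∘ there))

  foldr-max∞-≥ : ∀ {xs p} → p ∈ xs → g p ≤∞ foldr max∞ (fin 0) (map g xs)
  foldr-max∞-≥ (here refl) = max∞-≥ˡ _ _
  foldr-max∞-≥ (there p∈)  = ≤∞-trans (foldr-max∞-≥ p∈) (max∞-≥ʳ _ _)

module _ {A : Set} where

  record Selection {k} (F : Vec A (suc k)) (v : A) (F′ : Vec A k) : Set where
    field
      selected : v ∈V F
      rest⊆    : ∀ {u} → u ∈V F′ → u ∈V F
      rest⊇    : ∀ {u} → u ∈V F → u ≢ v → u ∈V F′

  open Selection public

  picks-selection : ∀ {k} (F : Vec A (suc k)) {v F′} → (v , F′) ∈ picks F → Selection F v F′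
  picks-selection (x ∷ []) (here refl) = record
    { selected = VAny.here refl
    ; rest⊆    = λ ()
    ; rest⊇    = λ { (VAny.here refl) u≢x → ⊥-elim (u≢x refl) }
    }
  picks-selection (x ∷ y ∷ ys) (here refl) = record
    { selected = VAny.here refl
    ; rest⊆    = VAny.there
    ; rest⊇    = λ { (VAny.here refl) u≢x → ⊥-elim (u≢x refl) ; (VAny.there u∈) _ → u∈ }
    }
  picks-selection (x ∷ y ∷ ys) (there sel) with ∈-map⁻ _ sel
  ... | (v , F′) , sel′ , refl = record
    { selected = VAny.there (selected S)
    ; rest⊆    = λ { (VAny.here refl) → VAny.here refl
                   ; (VAny.there u∈) → VAny.there (rest⊆ S u∈) }
    ; rest⊇    = λ { (VAny.here refl) _ → VAny.here refl
                   ; (VAny.there u∈) u≢v → VAny.there (rest⊇ S u∈ u≢v) }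
    }
    where S = picks-selection (y ∷ ys) sel′

  picks-complete : ∀ {k} {F : Vec A (suc k)} {v} → v ∈V F → ∃ λ F′ → (v , F′) ∈ picks F
  picks-complete {F = x ∷ []}     (VAny.here refl) = [] , here refl
  picks-complete {F = x ∷ y ∷ ys} (VAny.here refl) = y ∷ ys , here refl
  picks-complete {F = x ∷ y ∷ ys} (VAny.there v∈) with picks-complete v∈
  ... | F′ , sel = x ∷ F′ , there (∈-map⁺ _ sel)

  picks-head : ∀ {k} x (xs : Vec A k) → (x , xs) ∈ picks (x ∷ xs)
  picks-head x []       = here refl
  picks-head x (y ∷ ys) = here refl

module _ {G : Graph} where

  infixr 5 _++ʷ_

  _++ʷ_ : ∀ {u v w} → Walk G u v → Walk G v w → Walk G u w
  here      ++ʷ q = q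
  step uw p ++ʷ q = step uw (p ++ʷ q)

  reverseʷ : ∀ {u v} → Walk G u v → Walk G v u
  reverseʷ here                = here
  reverseʷ (step {u} {w} uw p) = reverseʷ p ++ʷ step (trans (Graph.sym G w u) uw) here

  connected-via-hub : ∀ h → (∀ u → Walk G u h) → Connected G
  connected-via-hub h to-h u v = to-h u ++ʷ reverseʷ (to-h v)

module Game (G : Graph) where

  V : Set
  V = Fin (n G)

  Dominated : List V → V → Set
  Dominated D v = Any (λ u → T (adj G v u)) D

  TotalDominating : List V → Set
  TotalDominating D = ∀ v → Dominated D v

  isTotalDominating-sound : ∀ {D} → isTotalDominating G D ≡ true → TotalDominating D
  isTotalDominating-sound {D} td v =
    any⁻ (adj G v) D (All.lookup (all⁺ _ _ (Equivalence.from T-≡ td)) (∈-toList⁺ (∈-allFin⁺ v)))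

  isTotalDominating-complete : ∀ {D} → TotalDominating D → isTotalDominating G D ≡ true
  isTotalDominating-complete dom = Equivalence.to T-≡
    (all⁻ _ (All.universal (λ v → any⁺ (adj G v) (dom v)) (toList (allFin (n G)))))

  valD-≤-move : ∀ {k D} {F : Vec V (suc k)} {v F′} → (v , F′) ∈ picks F →
                valD G (suc k) D F ≤∞ suc∞ (valS G k (v ∷ D) F′)
  valD-≤-move {D = D} sel = if-≤∞ (isTotalDominating G D) λ _ → foldr-min∞-≤ sel

  ≤-valD-moves : ∀ {k D} {F : Vec V (suc k)} {x} → (isTotalDominating G D ≡ true → x ≤∞ fin 0) →
                 (∀ {v F′} → (v , F′) ∈ picks F → x ≤∞ suc∞ (valS G k (v ∷ D) F′)) →
                 x ≤∞ valD G (suc k) D F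
  ≤-valD-moves {D = D} {F} dominated bound =
    ≤∞-if (isTotalDominating G D) dominated λ _ → foldr-min∞-glb (picks F) bound

  ≤-valS-move : ∀ {k D} {F : Vec V (suc k)} {v F′ x} → (isTotalDominating G D ≡ true → x ≤∞ fin 0) →
                (v , F′) ∈ picks F → x ≤∞ valD G k D F′ → x ≤∞ valS G (suc k) D F
  ≤-valS-move {D = D} dominated sel bound =
    ≤∞-if (isTotalDominating G D) dominated λ _ → ≤∞-trans bound (foldr-max∞-≥ sel)

  valS-≤-moves : ∀ {k D} {F : Vec V (suc k)} {x} →
                 (∀ {v F′} → (v , F′) ∈ picks F → valD G k D F′ ≤∞ x) → valS G (suc k) D F ≤∞ x
  valS-≤-moves {D = D} {F} bound =
    if-≤∞ (isTotalDominating G D) λ _ → foldr-max∞-lub (picks F) bound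

  Needs : ℕ → List V → ∀ {k} → Vec V k → Set
  Needs m D F = ∀ E → All (_∈V F) E → TotalDominating (D ++ E) → m ≤ length E

  Needs-dominated : ∀ {m D k} {F : Vec V k} → Needs m D F → isTotalDominating G D ≡ true →
                    fin m ≤∞ fin 0
  Needs-dominated {D = D} needs td =
    fin≤fin (needs [] [] (subst TotalDominating (sym (++-identityʳ D)) (isTotalDominating-sound td)))

  Needs-claim : ∀ {m D k} {F : Vec V (suc k)} {v F′} →
                Needs (suc m) D F → Selection F v F′ → Needs m (v ∷ D) F′
  Needs-claim {D = D} {v = v} needs S E E⊆F′ dom = ≤-pred (needs (v ∷ E)
    (selected S ∷ All.map (rest⊆ S) E⊆F′)
    (λ u → Any-resp-↭ (↭-sym (shift v D E)) (dom u)))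

  Needs-tail : ∀ {m D k x} {F : Vec V k} → Needs m D (x ∷ F) → Needs m D F
  Needs-tail needs E E⊆F = needs E (All.map VAny.there E⊆F)

  mutual
    Needs⇒≤valD : ∀ {m D k} {F : Vec V k} → Needs m D F → fin m ≤∞ valD G k D F
    Needs⇒≤valD {zero} _ = 0≤∞
    Needs⇒≤valD {suc m} {D} {zero} needs =
      ≤∞-if (isTotalDominating G D) (Needs-dominated needs) λ _ → _ ≤∞-∞
    Needs⇒≤valD {suc m} {D} {suc k} {F} needs = ≤-valD-moves (Needs-dominated needs) λ sel →
      suc∞-mono (Needs⇒≤valS (Needs-claim needs (picks-selection F sel)))

    Needs⇒≤valS : ∀ {m D k} {F : Vec V k} → Needs m D F → fin m ≤∞ valS G k D F
    Needs⇒≤valS {zero} _ = 0≤∞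
    Needs⇒≤valS {suc m} {D} {zero} needs =
      ≤∞-if (isTotalDominating G D) (Needs-dominated needs) λ _ → _ ≤∞-∞
    Needs⇒≤valS {suc m} {D} {suc k} {x ∷ F} needs =
      ≤-valS-move (Needs-dominated needs) (picks-head x F) (Needs⇒≤valD (Needs-tail needs))

  packing-bound : ∀ {m} {Allowed : V → Set} (w : Fin m → V) (owner : V → Fin m) →
                  (∀ i {u} → Allowed u → T (adj G (w i) u) → owner u ≡ i) →
                  ∀ {E} → All Allowed E → TotalDominating E → m ≤ length E
  packing-bound w owner owns {E} allowed dom = injective⇒≤ dominator-injective
    where
    dominator-owner : ∀ i → owner (Any.lookup (dom (w i))) ≡ i
    dominator-owner i = All.lookupWith (owns i) allowed (dom (w i))

    dominator-injective : Injective _≡_ _≡_ (λ i → Any.index (dom (w i)))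
    dominator-injective {i} {j} same =
      trans (sym (dominator-owner i)) (trans (cong (owner ∘ List.lookup E) same) (dominator-owner j))

  record Pairing (m : ℕ) (D : List V) {k} (F : Vec V k) : Set where
    field
      pair      : Fin m → Bool → V
      injective : Injective _≡_ _≡_ (uncurry pair)
      free      : ∀ i β → pair i β ∈V F
      covers    : ∀ v → Dominated D v ⊎ ∃ λ i → ∀ β → T (adj G v (pair i β))

  open Pairing

  Pairing-dominates : ∀ {D k} {F : Vec V k} → Pairing 0 D F → isTotalDominating G D ≡ true
  Pairing-dominates P = isTotalDominating-complete λ v → [ id , (λ { (() , _) }) ]′ (covers P v)

  Pairing-restrict : ∀ {m D k k′ v} {F : Vec V k} {F′ : Vec V k′} (P : Pairing m D F) →
                     (∀ {u} → u ∈V F → u ≢ v → u ∈V F′) → (∀ i β → pair P i β ≢ v) → Pairing m D F′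
  Pairing-restrict P keep avoids = record
    { pair      = pair P
    ; injective = injective P
    ; free      = λ i β → keep (free P i β) (avoids i β)
    ; covers    = covers P
    }

  Pairing-claim : ∀ {m D k k′} {F : Vec V k} {F′ : Vec V k′} (P : Pairing (suc m) D F) i β →
                  (∀ {u} → u ∈V F → (∀ γ → pair P i γ ≢ u) → u ∈V F′) →
                  Pairing m (pair P i β ∷ D) F′
  Pairing-claim {D = D} P i β keep = record
    { pair      = pair P ∘ punchIn i
    ; injective = λ {(j , γ)} {(j′ , δ)} same →
        let e = injective P {punchIn i j , γ} {punchIn i j′ , δ} same
        in cong₂ _,_ (punchIn-injective i j j′ (cong proj₁ e)) (cong proj₂ e)
    ; free      = λ j γ → keep (free P (punchIn i j) γ) λ δ same →
        punchInᵢ≢i i j (sym (cong proj₁ (injective P {i , δ} {punchIn i j , γ} same)))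
    ; covers    = covers′
    }
    where
    covers′ : ∀ v → Dominated (pair P i β ∷ D) v ⊎ ∃ λ j → ∀ γ → T (adj G v (pair P (punchIn i j) γ))
    covers′ v with covers P v
    ... | inj₁ dom = inj₁ (there dom)
    ... | inj₂ (j , adjacent) with i ≟ j
    ...   | yes refl = inj₁ (here (adjacent β))
    ...   | no i≢j   = inj₂ (punchOut i≢j , λ γ →
            subst (λ j → T (adj G v (pair P j γ))) (sym (punchIn-punchOut i≢j)) (adjacent γ))

  occurrence? : ∀ {m D k} {F : Vec V k} (P : Pairing m D F) v → Dec (∃₂ λ i β → pair P i β ≡ v)
  occurrence? P v = map′
    (λ { (i , inj₁ e) → i , false , e ; (i , inj₂ e) → i , true , e })
    (λ { (i , false , e) → i , inj₁ e ; (i , true , e) → i , inj₂ e })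
    (any? λ i → (pair P i false ≟ v) ⊎-dec (pair P i true ≟ v))

  mutual
    Pairing⇒valD≤ : ∀ {m D k} {F : Vec V k} → Pairing m D F → valD G k D F ≤∞ fin m
    Pairing⇒valD≤ {zero} {k = zero}  P = if-true-≤∞ (Pairing-dominates P)
    Pairing⇒valD≤ {zero} {k = suc k} P = if-true-≤∞ (Pairing-dominates P)
    Pairing⇒valD≤ {suc m} P = claim⇒valD≤ P zero false (free P zero false) λ u∈F _ → u∈F

    Pairing⇒valS≤ : ∀ {m D k} {F : Vec V k} → Pairing m D F → valS G k D F ≤∞ fin m
    Pairing⇒valS≤ {zero} {k = zero}  P = if-true-≤∞ (Pairing-dominates P)
    Pairing⇒valS≤ {zero} {k = suc k} P = if-true-≤∞ (Pairing-dominates P)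
    Pairing⇒valS≤ {suc m} {k = zero} {F = []} P with free P zero false
    ... | ()
    Pairing⇒valS≤ {suc m} {D} {suc k} {F} P = valS-≤-moves λ sel → answer (picks-selection F sel)
      where
      answer : ∀ {v F′} → Selection F v F′ → valD G k D F′ ≤∞ fin (suc m)
      answer {v} S with occurrence? P v
      ... | no v∉P = Pairing⇒valD≤ (Pairing-restrict P (rest⊇ S) λ i β e → v∉P (i , β , e))
      ... | yes (i , β , refl) = claim⇒valD≤ P i (not β) (rest⊇ S (free P i (not β)) partner≢v)
                                   λ u∈F u∉P → rest⊇ S u∈F (u∉P β ∘ sym)
        where
        partner≢v : pair P i (not β) ≢ pair P i β
        partner≢v same = not-¬ refl (sym (cong proj₂ (injective P {i , not β} {i , β} same)))

    claim⇒valD≤ : ∀ {m D k k₀} {F₀ : Vec V k₀} {F : Vec V k} (P : Pairing (suc m) D F₀) i β →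
                  pair P i β ∈V F → (∀ {u} → u ∈V F₀ → (∀ γ → pair P i γ ≢ u) → u ∈V F) →
                  valD G k D F ≤∞ fin (suc m)
    claim⇒valD≤ {k = zero} {F = []} P i β ()
    claim⇒valD≤ {k = suc k} {F₀ = F₀} {F} P i β w∈F keep with picks-complete w∈F
    ... | F′ , sel = ≤∞-trans (valD-≤-move sel) (suc∞-mono (Pairing⇒valS≤ (Pairing-claim P i β keep′)))
      where
      keep′ : ∀ {u} → u ∈V F₀ → (∀ γ → pair P i γ ≢ u) → u ∈V F′
      keep′ u∈F₀ u∉P = rest⊇ (picks-selection F sel) (keep u∈F₀ u∉P) (u∉P β ∘ sym)

fin-+↔⊎ : ∀ {m n} {A B : Set} → Fin m ↔ A → Fin n ↔ B → Fin (m + n) ↔ (A ⊎ B)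
fin-+↔⊎ f g = (f ⊎-↔ g) ↔-∘ +↔⊎

module SimpleGraph {V : Set} {N : ℕ} (indexing : Fin N ↔ V)
                   (E : V → V → Bool) (E-irrefl : ∀ s → E s s ≡ false) where

  open Inverse indexing public using () renaming (to to label; from to vertex)
  open Inverse indexing using (strictlyInverseˡ; strictlyInverseʳ)

  Adj : V → V → Bool
  Adj s t = E s t ∨ E t s

  graph : Graph
  graph = record
    { n      = N
    ; adj    = λ u v → Adj (label u) (label v)
    ; sym    = λ u v → ∨-comm (E (label u) (label v)) (E (label v) (label u))
    ; irrefl = λ u → cong₂ _∨_ (E-irrefl (label u)) (E-irrefl (label u))
    }

  label-vertex : ∀ s → label (vertex s) ≡ s
  label-vertex = strictlyInverseˡ

  vertex-label : ∀ u → vertex (label u) ≡ u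
  vertex-label = strictlyInverseʳ

  vertex-injective : ∀ {s t} → vertex s ≡ vertex t → s ≡ t
  vertex-injective {s} {t} same =
    trans (sym (label-vertex s)) (trans (cong label same) (label-vertex t))

  adj-from-vertex : ∀ s u → T (adj graph (vertex s) u) → T (Adj s (label u))
  adj-from-vertex s u = subst (λ s′ → T (Adj s′ (label u))) (label-vertex s)

  adj-to-vertex : ∀ u t → T (Adj (label u) t) → T (adj graph u (vertex t))
  adj-to-vertex u t = subst (λ t′ → T (Adj (label u) t′)) (sym (label-vertex t))

  edge-step : ∀ s t {u} → T (Adj s t) → Walk graph (vertex t) u → Walk graph (vertex s) u
  edge-step s t st = step {w = vertex t}
    (trans (cong₂ Adj (label-vertex s) (label-vertex t)) (Equivalence.to T-≡ st))

module Construction (a b : ℕ) where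

  A M : ℕ
  A = suc a
  M = A + b

  Gadget : Set
  Gadget = Fin A ⊎ Fin b

  Vx : Set
  Vx = ⊤ ⊎ (Bool ⊎ ((Gadget × Bool) ⊎ Gadget))

  pattern c     = inj₁ tt
  pattern z β   = inj₂ (inj₁ β)
  pattern y g β = inj₂ (inj₂ (inj₁ (g , β)))
  pattern x g   = inj₂ (inj₂ (inj₂ g))

  indexing : Fin (1 + (2 + (M * 2 + M))) ↔ Vx
  indexing = fin-+↔⊎ 1↔⊤ (fin-+↔⊎ 2↔Bool (fin-+↔⊎ ((+↔⊎ ×-↔ 2↔Bool) ↔-∘ *↔×) +↔⊎))

  _≟ᴳ_ : DecidableEquality Gadget
  _≟ᴳ_ = ≡-dec _≟_ _≟_

  E : Vx → Vx → Bool
  E c       (z _)        = true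
  E c       (x (inj₁ _)) = true
  E (z _)   (y _ _)      = true
  E (y g _) (x g′)       = ⌊ g ≟ᴳ g′ ⌋
  E _       _            = false

  E-irrefl : ∀ s → E s s ≡ false
  E-irrefl c       = refl
  E-irrefl (z _)   = refl
  E-irrefl (y _ _) = refl
  E-irrefl (x _)   = refl

  open SimpleGraph indexing E E-irrefl public
  open Game graph

  gadget-edge : ∀ g β → T (Adj (x g) (y g β))
  gadget-edge g β = fromWitness refl

  gadget-edge⁻ : ∀ g g′ β → T (Adj (x g) (y g′ β)) → g′ ≡ g
  gadget-edge⁻ _ _ _ = toWitness

  walk-to-c : ∀ s → Walk graph (vertex s) (vertex c)
  walk-to-c c       = here
  walk-to-c (z β)   = edge-step (z β) c _ here
  walk-to-c (y g β) = edge-step (y g β) (z β) _ (walk-to-c (z β))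
  walk-to-c (x g)   = edge-step (x g) (y g false) (gadget-edge g false)
                        (edge-step (y g false) (z false) _ (walk-to-c (z false)))

  connected : Connected graph
  connected = connected-via-hub (vertex c) λ u →
    subst (λ u → Walk graph u (vertex c)) (vertex-label u) (walk-to-c (label u))

  g₀ : Gadget
  g₀ = inj₁ zero

  pairS : Fin (suc M) → Bool → Vx
  pairS zero    β = z β
  pairS (suc i) β = y (splitAt A i) β

  -- The index of the S-pair containing a vertex; it is also the owner map of the S-game packing.
  slotS : Vx → Fin (suc M)
  slotS (y g _) = suc (join A b g)
  slotS _       = zero

  side : Vx → Bool
  side (z β)   = β
  side (y _ β) = β
  side _       = false

  slotS-side-pairS : ∀ i β → (slotS (pairS i β) , side (pairS i β)) ≡ (i , β)
  slotS-side-pairS zero    β = refl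
  slotS-side-pairS (suc i) β = cong (λ j → suc j , β) (join-splitAt A b i)

  pairS-injective : Injective _≡_ _≡_ (uncurry pairS)
  pairS-injective {i , β} {j , γ} same = trans (sym (slotS-side-pairS i β))
    (trans (cong (λ s → slotS s , side s) same) (slotS-side-pairS j γ))

  pairS-covers : ∀ s → ∃ λ i → ∀ β → T (Adj s (pairS i β))
  pairS-covers c       = zero , _
  pairS-covers (z _)   = suc zero , _
  pairS-covers (y _ _) = zero , _
  pairS-covers (x g)   = suc (join A b g) , λ β →
    subst (λ g′ → T (Adj (x g) (y g′ β))) (sym (splitAt-join A b g)) (gadget-edge g β)

  pairingS : Pairing (suc M) [] (allFin (n graph))
  pairingS = record
    { pair      = λ i β → vertex (pairS i β)
    ; injective = pairS-injective ∘ vertex-injective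
    ; free      = λ _ _ → ∈-allFin⁺ _
    ; covers    = λ u → let (i , adjacent) = pairS-covers (label u) in
                        inj₂ (i , λ β → adj-to-vertex u _ (adjacent β))
    }

  pairD : Fin (suc b) → Bool → Vx
  pairD zero    β = z β
  pairD (suc j) β = y (inj₂ j) β

  pairD-injective : Injective _≡_ _≡_ (uncurry pairD)
  pairD-injective {zero  , _} {zero  , _} refl = refl
  pairD-injective {suc _ , _} {suc _ , _} refl = refl
  pairD-injective {zero  , _} {suc _ , _} ()
  pairD-injective {suc _ , _} {zero  , _} ()

  pairD-covers : ∀ s → T (Adj s c) ⊎ ∃ λ j → ∀ β → T (Adj s (pairD j β))
  pairD-covers c            = inj₂ (zero , _)
  pairD-covers (z _)        = inj₁ _
  pairD-covers (y _ _)      = inj₂ (zero , _)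
  pairD-covers (x (inj₁ _)) = inj₁ _
  pairD-covers (x (inj₂ j)) = inj₂ (suc j , gadget-edge (inj₂ j))

  pairingD : Pairing (suc b) (vertex c ∷ []) (tabulate suc)
  pairingD = record
    { pair      = λ j β → vertex (pairD j β)
    ; injective = pairD-injective ∘ vertex-injective
    ; free      = λ { zero β → ∈-tabulate⁺ suc _ ; (suc j) β → ∈-tabulate⁺ suc _ }
    ; covers    = λ u → [ (λ adjacent → inj₁ (here (adj-to-vertex u c adjacent)))
                        , (λ { (j , adjacent) → inj₂ (j , λ β → adj-to-vertex u _ (adjacent β)) }) ]′
                        (pairD-covers (label u))
    }

  witnessS : Fin (suc M) → Vx
  witnessS zero    = y g₀ false
  witnessS (suc i) = x (splitAt A i)

  slotS-witnessS : ∀ i s → s ≢ c → T (Adj (witnessS i) s) → slotS s ≡ i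
  slotS-witnessS zero    c       _   ()
  slotS-witnessS zero    (z _)   _   _ = refl
  slotS-witnessS zero    (y _ _) _   ()
  slotS-witnessS zero    (x _)   _   _ = refl
  slotS-witnessS (suc i) c       c≢c _ = ⊥-elim (c≢c refl)
  slotS-witnessS (suc i) (z _)   _   ()
  slotS-witnessS (suc i) (y g β) _   adjacent =
    cong suc (trans (cong (join A b) (gadget-edge⁻ _ g β adjacent)) (join-splitAt A b i))
  slotS-witnessS (suc i) (x _)   _   ()

  witnessD : Fin (2 + b) → Vx
  witnessD zero          = y g₀ false
  witnessD (suc zero)    = x g₀
  witnessD (suc (suc j)) = x (inj₂ j)

  ownerD : Vx → Fin (2 + b)
  ownerD c              = suc zero
  ownerD (y (inj₁ _) _) = suc zero
  ownerD (y (inj₂ j) _) = suc (suc j)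
  ownerD _              = zero

  ownerD-witnessD : ∀ i s → T (Adj (witnessD i) s) → ownerD s ≡ i
  ownerD-witnessD zero          c       ()
  ownerD-witnessD zero          (z _)   _ = refl
  ownerD-witnessD zero          (y _ _) ()
  ownerD-witnessD zero          (x _)   _ = refl
  ownerD-witnessD (suc zero)    c       _ = refl
  ownerD-witnessD (suc zero)    (z _)   ()
  ownerD-witnessD (suc zero)    (y g β) adjacent with refl ← gadget-edge⁻ g₀ g β adjacent = refl
  ownerD-witnessD (suc zero)    (x _)   ()
  ownerD-witnessD (suc (suc j)) c       ()
  ownerD-witnessD (suc (suc j)) (z _)   ()
  ownerD-witnessD (suc (suc j)) (y g β) adjacent with refl ← gadget-edge⁻ (inj₂ j) g β adjacent = refl
  ownerD-witnessD (suc (suc j)) (x _)   ()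

  pick-c : (vertex c , tabulate suc) ∈ picks (allFin (n graph))
  pick-c = picks-head (vertex c) (tabulate suc)

  γMBT-upper : γMBT graph ≤∞ fin (suc (suc b))
  γMBT-upper = ≤∞-trans (valD-≤-move {D = []} {F = allFin (n graph)} pick-c)
                        (suc∞-mono (Pairing⇒valS≤ pairingD))

  γMBT-lower : fin (suc (suc b)) ≤∞ γMBT graph
  γMBT-lower = Needs⇒≤valD {D = []} {F = allFin (n graph)} λ E E⊆V dom →
    packing-bound (vertex ∘ witnessD) (ownerD ∘ label)
      (λ i {u} _ adjacent → ownerD-witnessD i (label u) (adj-from-vertex _ u adjacent)) E⊆V dom

  γMBT′-lower : fin (suc M) ≤∞ γMBT' graph
  γMBT′-lower = ≤-valS-move {D = []} {F = allFin (n graph)} (λ ()) pick-c (Needs⇒≤valD λ E E⊆F dom →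
      packing-bound (vertex ∘ witnessS) (slotS ∘ label) owns (All.map avoids-c E⊆F) dom)
    where
    avoids-c : ∀ {u} → u ∈V tabulate suc → u ≢ vertex c
    avoids-c u∈ with VAny.tabulate⁻ {f = suc} u∈
    ... | _ , refl = λ ()

    owns : ∀ i {u} → u ≢ vertex c → T (adj graph (vertex (witnessS i)) u) → slotS (label u) ≡ i
    owns i {u} u≢c adjacent = slotS-witnessS i (label u)
      (λ u-is-c → u≢c (trans (sym (vertex-label u)) (cong vertex u-is-c))) (adj-from-vertex _ u adjacent)

  γMBT-graph : γMBT graph ≡ fin (suc (suc b))
  γMBT-graph = ≤∞-antisym γMBT-upper γMBT-lower

  γMBT′-graph : γMBT' graph ≡ fin (suc M)
  γMBT′-graph = ≤∞-antisym (Pairing⇒valS≤ pairingS) γMBT′-lower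

theorem3p3 : (k ℓ : ℕ) → 2 ≤ k → k ≤ ℓ →
    Σ Graph (λ G → Connected G × γMBT G ≡ fin k × γMBT' G ≡ fin ℓ)
theorem3p3 (suc (suc b)) ℓ (s≤s (s≤s z≤n)) k≤ℓ with m≤n⇒∃[o]m+o≡n k≤ℓ
... | a , refl =
  graph , connected , γMBT-graph , trans γMBT′-graph (cong (λ t → fin (suc (suc t))) (+-comm a b))
  where open Construction a b
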